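{- Let $D$ be a positive integer and $a$ an integer with $4\mid a$. Then there exist integers $v_1,v_2$ with $\gcd(D,v_1)=\gcd(D,v_2)=1$ such that either $(v_1-1)(v_2-1)\equiv a\pmod D$ or $(v_1+1)(v_2-1)\equiv a\pmod D$. -}

module Defs where

open import Data.Integer using (ℤ; _-_)
open import Data.Integer.Divisibility using (_∣_)

CongMod : ℤ → ℤ → ℤ → Set
CongMod m x y = m ∣ (x - y)

{-# OPTIONS --safe #-}
-- Write a = 4b.  Split D = m n with m prime to g = 1 - 2b and every prime of n
-- dividing g, and let e be the idempotent with e ≡ 0 (mod m), e ≡ 1 (mod n).
-- Then u = 2e - 1 satisfies u² ≡ 1 (mod D), so v₁ = 1 + 2bu and v₂ = 2u + 1
-- give (v₁ - 1)(v₂ - 1) = 4bu² ≡ a.  Modulo m these are g and -1, modulo n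
-- they are 1 + 2b and 3; the first two are units, and so are the last two
-- (1 + 2b is prime to g) as soon as g is prime to 3.  If 3 ∣ 1 - 2b, replace b by -b and v₁ by -v₁,
-- which yields the second form.
module Submission where

open import Defs
open import Data.Integer using (ℤ; +_; _+_; _-_; _*_; _<_; 1ℤ; 0ℤ)
open import Data.Integer.Divisibility using (_∣_)
open import Data.Integer.GCD using (gcd)
open import Data.Product using (∃₂; _×_)
open import Data.Sum using (_⊎_)
open import Relation.Binary.PropositionalEquality using (_≡_)

open import Data.Integer using (-_; ∣_∣; +<+)
open import Data.Integer.Properties using (+-comm; *-identityʳ; pos-*; pos-+)
import Data.Integer.Divisibility.Signed as Signed
open Signed using (divides; ∣ᵤ⇒∣; ∣⇒∣ᵤ; ∣-refl; ∣n⇒∣m*n; ∣m⇒∣-m; ∣m∣n⇒∣m+n; m∣∣m∣)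
open import Data.Integer.GCD using (gcd[i,j]∣i; gcd[i,j]∣j)
open import Data.Integer.DivMod using (_%ℕ_; _/ℕ_; a≡a%ℕn+[a/ℕn]*n; n%ℕd<d)
open import Data.Integer.Tactic.RingSolver using (solve-∀)
open import Data.Nat as ℕ using (suc; s≤s; NonZero; NonTrivial; >-nonZero)
import Data.Nat.Divisibility as ℕ
open import Data.Nat.Coprimality using (gcd≡1⇒coprime; coprime-Bézout)
open import Data.Nat.GCD as ℕ using (gcd[m,n]∣m; gcd[m,n]∣n; gcd[m,n]≢0; module Bézout)
open import Data.Nat.Induction using (<-rec)
open import Data.Product using (∃; _,_)
open import Data.Sum as Sum using (inj₁; inj₂)
open import Relation.Nullary using (yes; no; contradiction)
open import Relation.Binary.PropositionalEquality
  using (refl; sym; trans; cong; cong₂; subst; _≢_; module ≡-Reasoning)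
open import Function using (_∘_)

Coprime : ℤ → ℤ → Set
Coprime i j = ∃₂ λ α β → α * i + β * j ≡ 1ℤ

coprime-sym : ∀ {i j} → Coprime i j → Coprime j i
coprime-sym {i} {j} (α , β , eq) = β , α , trans (+-comm (β * j) (α * i)) eq

coprime-*ˡ : ∀ {i j k} → Coprime i k → Coprime j k → Coprime (i * j) k
coprime-*ˡ {i} {j} {k} (α , β , eq) (γ , δ , eq′) =
  α * γ , α * δ * i + β * γ * j + β * δ * k , trans (expand α β γ δ i j k) (cong₂ _*_ eq eq′)
  where
  expand : ∀ α β γ δ i j k →
    α * γ * (i * j) + (α * δ * i + β * γ * j + β * δ * k) * k ≡ (α * i + β * k) * (γ * j + δ * k)
  expand = solve-∀

coprime-∣ʳ : ∀ {i j d} → d Signed.∣ j → Coprime i j → Coprime i d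
coprime-∣ʳ {i} (divides q refl) (α , β , eq) = α , β * q , trans (reassociate α β q i _) eq
  where
  reassociate : ∀ α β q i d → α * i + β * q * d ≡ α * i + β * (q * d)
  reassociate = solve-∀

coprime-∣ˡ : ∀ {i j d} → d Signed.∣ i → Coprime i j → Coprime d j
coprime-∣ˡ d∣i = coprime-sym ∘ coprime-∣ʳ d∣i ∘ coprime-sym

coprime-neg : ∀ {i j} → Coprime i j → Coprime i (- j)
coprime-neg {i} {j} (α , β , eq) = α , - β , trans (neg-neg α β i j) eq
  where
  neg-neg : ∀ α β i j → α * i + - β * - j ≡ α * i + β * j
  neg-neg = solve-∀

coprime-resp-≡mod : ∀ {m v w} → Coprime m w → m Signed.∣ v - w → Coprime m v
coprime-resp-≡mod {m} {v} {w} (α , β , eq) (divides q v-w≡qm) =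
  α - β * q , β , (begin
    (α - β * q) * m + β * v             ≡⟨ cong (λ z → (α - β * q) * m + β * z) (add-back v w) ⟩
    (α - β * q) * m + β * (v - w + w)   ≡⟨ cong (λ z → (α - β * q) * m + β * (z + w)) v-w≡qm ⟩
    (α - β * q) * m + β * (q * m + w)   ≡⟨ cancel α β q m w ⟩
    α * m + β * w                       ≡⟨ eq ⟩
    1ℤ                                  ∎)
  where
  open ≡-Reasoning
  add-back : ∀ v w → v ≡ v - w + w
  add-back = solve-∀
  cancel : ∀ α β q m w → (α - β * q) * m + β * (q * m + w) ≡ α * m + β * w
  cancel = solve-∀

coprime⇒gcd≡1 : ∀ {i j} → Coprime i j → gcd i j ≡ 1ℤ
coprime⇒gcd≡1 {i} {j} (α , β , eq) = cong +_ (ℕ.∣1⇒≡1 (∣⇒∣ᵤ gcd∣1))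
  where
  gcd∣1 : gcd i j Signed.∣ 1ℤ
  gcd∣1 = subst (gcd i j Signed.∣_) eq
    (∣m∣n⇒∣m+n (∣n⇒∣m*n α (∣ᵤ⇒∣ (gcd[i,j]∣i i j))) (∣n⇒∣m*n β (∣ᵤ⇒∣ (gcd[i,j]∣j i j))))

Bézout⇒coprime : ∀ {m n} → Bézout.Identity 1 m n → Coprime (+ m) (+ n)
Bézout⇒coprime {m} {n} (Bézout.+- x y eq) = + x , - + y , (begin
  + x * + m + - + y * + n                 ≡⟨ cong (λ k → k + - + y * + n) lifted ⟩
  1ℤ + + y * + n + - + y * + n            ≡⟨ cancel (+ y) (+ n) ⟩
  1ℤ                                      ∎)
  where
  open ≡-Reasoning
  lifted : + x * + m ≡ 1ℤ + + y * + n
  lifted = begin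
    + x * + m         ≡⟨ pos-* x m ⟨
    + (x ℕ.* m)       ≡⟨ cong +_ eq ⟨
    + (1 ℕ.+ y ℕ.* n) ≡⟨ pos-+ 1 (y ℕ.* n) ⟩
    1ℤ + + (y ℕ.* n)  ≡⟨ cong (λ k → 1ℤ + k) (pos-* y n) ⟩
    1ℤ + + y * + n    ∎
  cancel : ∀ c d → 1ℤ + c * d + - c * d ≡ 1ℤ
  cancel = solve-∀
Bézout⇒coprime (Bézout.-+ x y eq) = coprime-sym (Bézout⇒coprime (Bézout.+- y x eq))

-- The field coprime-n is a choice-free way of saying that every prime factor of n divides g.
record CoprimeSplitting (D g : ℤ) : Set where
  field
    m n          : ℤ
    m*n≡D        : m * n ≡ D
    coprime[m,n] : Coprime m n
    coprime[m,g] : Coprime m g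
    coprime-n    : ∀ {c} → Coprime g c → Coprime n c

≢0∧≢1⇒nonTrivial : ∀ {d} → d ≢ 0 → d ≢ 1 → NonTrivial d
≢0∧≢1⇒nonTrivial {0}           d≢0 _   = contradiction refl d≢0
≢0∧≢1⇒nonTrivial {1}           _   d≢1 = contradiction refl d≢1
≢0∧≢1⇒nonTrivial {suc (suc _)} _   _   = _

-- If d = gcd(M, g) > 1, split M / d and move d into the g-part.
splitting : ∀ g M → .{{NonZero M}} → CoprimeSplitting (+ M) g
splitting g = <-rec (λ M → .{{NonZero M}} → CoprimeSplitting (+ M) g) step
  where
  step : ∀ M → (∀ {q} → q ℕ.< M → .{{NonZero q}} → CoprimeSplitting (+ q) g) →
         .{{NonZero M}} → CoprimeSplitting (+ M) g
  step M rec with ℕ.gcd M ∣ g ∣ ℕ.≟ 1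
  ... | yes gcd≡1 = record
    { m            = + M
    ; n            = 1ℤ
    ; m*n≡D        = *-identityʳ (+ M)
    ; coprime[m,n] = 0ℤ , 1ℤ , refl
    ; coprime[m,g] = coprime-∣ʳ m∣∣m∣ (Bézout⇒coprime (coprime-Bézout (gcd≡1⇒coprime gcd≡1)))
    ; coprime-n    = λ _ → 1ℤ , 0ℤ , refl
    }
  ... | no gcd≢1 = record
    { m            = S.m
    ; n            = + d * S.n
    ; m*n≡D        = m*n≡M
    ; coprime[m,n] = coprime-sym (coprime-*ˡ (coprime-sym (coprime-∣ʳ d∣g S.coprime[m,g]))
                                            (coprime-sym S.coprime[m,n]))
    ; coprime[m,g] = S.coprime[m,g]
    ; coprime-n    = λ g⊥c → coprime-*ˡ (coprime-∣ˡ d∣g g⊥c) (S.coprime-n g⊥c)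
    }
    where
    open ≡-Reasoning
    d = ℕ.gcd M ∣ g ∣
    d∣M = gcd[m,n]∣m M ∣ g ∣
    q = ℕ.quotient d∣M
    instance
      _ : NonTrivial d
      _ = ≢0∧≢1⇒nonTrivial (gcd[m,n]≢0 M ∣ g ∣ (inj₁ (ℕ.≢-nonZero⁻¹ M))) gcd≢1
      _ : NonZero q
      _ = ℕ.quotient≢0 d∣M
    module S = CoprimeSplitting (rec (ℕ.quotient-< d∣M))
    d∣g : + d Signed.∣ g
    d∣g = ∣ᵤ⇒∣ (gcd[m,n]∣n M ∣ g ∣)
    rearrange : ∀ m d n → m * (d * n) ≡ m * n * d
    rearrange = solve-∀
    m*n≡M : S.m * (+ d * S.n) ≡ + M
    m*n≡M = begin
      S.m * (+ d * S.n) ≡⟨ rearrange S.m (+ d) S.n ⟩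
      S.m * S.n * + d   ≡⟨ cong (_* + d) S.m*n≡D ⟩
      + q * + d         ≡⟨ pos-* q d ⟨
      + (q ℕ.* d)       ≡⟨ cong +_ (ℕ._∣_.equality d∣M) ⟨
      + M               ∎

∣-*-∣ : ∀ {i j k l} → i Signed.∣ j → k Signed.∣ l → i * k Signed.∣ j * l
∣-*-∣ {i} {_} {k} (divides p refl) (divides q refl) = divides (p * q) (regroup p i q k)
  where
  regroup : ∀ p i q k → p * i * (q * k) ≡ p * q * (i * k)
  regroup = solve-∀

coprime-*-≡mod : ∀ {m n v w w′} → Coprime m w → m Signed.∣ v - w →
                 Coprime n w′ → n Signed.∣ v - w′ → Coprime (m * n) v
coprime-*-≡mod m⊥w m∣v-w n⊥w′ n∣v-w′ =
  coprime-*ˡ (coprime-resp-≡mod m⊥w m∣v-w) (coprime-resp-≡mod n⊥w′ n∣v-w′)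

idempotent : ∀ {m n} → Coprime m n → ∃ λ e → m Signed.∣ e × n Signed.∣ e - 1ℤ
idempotent {m} {n} (x , y , bez) = x * m , ∣n⇒∣m*n x ∣-refl , divides (- y) (begin
  x * m - 1ℤ              ≡⟨ cong (λ z → x * m - z) bez ⟨
  x * m - (x * m + y * n) ≡⟨ cancel x m y n ⟩
  - y * n                 ∎)
  where
  open ≡-Reasoning
  cancel : ∀ x m y n → x * m - (x * m + y * n) ≡ - y * n
  cancel = solve-∀

coprime[1-2b,1+2b] : ∀ b → Coprime (1ℤ - + 2 * b) (1ℤ + + 2 * b)
coprime[1-2b,1+2b] b = - b , 1ℤ - b , combination b
  where
  combination : ∀ b → - b * (1ℤ - + 2 * b) + (1ℤ - b) * (1ℤ + + 2 * b) ≡ 1ℤ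
  combination = solve-∀

ShiftedUnitPair : ℤ → ℤ → Set
ShiftedUnitPair D a = ∃₂ λ v₁ v₂ → Coprime D v₁ × Coprime D v₂ × D Signed.∣ (v₁ - 1ℤ) * (v₂ - 1ℤ) - a

-- With u = 2e - 1 we have u ≡ -1 (mod m), u ≡ 1 (mod n) and u² - 1 = 4 e (e - 1) ≡ 0 (mod m n).
idempotent⇒shifted-unit-pair : ∀ {D m n} b → m * n ≡ D → (∃ λ e → m Signed.∣ e × n Signed.∣ e - 1ℤ) →
  Coprime m (1ℤ - + 2 * b) → Coprime n (1ℤ + + 2 * b) → Coprime n (+ 3) →
  ShiftedUnitPair D (b * + 4)
idempotent⇒shifted-unit-pair b refl (e , m∣e , n∣e-1) m⊥1-2b n⊥1+2b n⊥3 =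
  v₁ , v₂ ,
  coprime-*-≡mod m⊥1-2b (via (+ 4 * b) (v₁-[1-2b] b e) m∣e)
                 n⊥1+2b (via (+ 4 * b) (v₁-[1+2b] b e) n∣e-1) ,
  coprime-*-≡mod {w = - 1ℤ} (0ℤ , - 1ℤ , refl) (via (+ 4) (v₂+1 e) m∣e)
                 n⊥3 (via (+ 4) (v₂-3 e) n∣e-1) ,
  via (+ 16 * b) (product b e) (∣-*-∣ m∣e n∣e-1)
  where
  v₁ v₂ : ℤ
  v₁ = 1ℤ + + 2 * b * (+ 2 * e - 1ℤ)
  v₂ = + 4 * e - 1ℤ
  via : ∀ {d x y} k → k * y ≡ x → d Signed.∣ y → d Signed.∣ x
  via k refl d∣y = ∣n⇒∣m*n k d∣y
  v₁-[1-2b] : ∀ b e → + 4 * b * e ≡ 1ℤ + + 2 * b * (+ 2 * e - 1ℤ) - (1ℤ - + 2 * b)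
  v₁-[1-2b] = solve-∀
  v₁-[1+2b] : ∀ b e → + 4 * b * (e - 1ℤ) ≡ 1ℤ + + 2 * b * (+ 2 * e - 1ℤ) - (1ℤ + + 2 * b)
  v₁-[1+2b] = solve-∀
  v₂+1 : ∀ e → + 4 * e ≡ + 4 * e - 1ℤ - - 1ℤ
  v₂+1 = solve-∀
  v₂-3 : ∀ e → + 4 * (e - 1ℤ) ≡ + 4 * e - 1ℤ - + 3
  v₂-3 = solve-∀
  product : ∀ b e → + 16 * b * (e * (e - 1ℤ)) ≡
                    (1ℤ + + 2 * b * (+ 2 * e - 1ℤ) - 1ℤ) * (+ 4 * e - 1ℤ - 1ℤ) - b * + 4
  product = solve-∀

shifted-unit-pair : ∀ b M → .{{NonZero M}} → Coprime (1ℤ - + 2 * b) (+ 3) →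
                    ShiftedUnitPair (+ M) (b * + 4)
shifted-unit-pair b M 1-2b⊥3 =
  idempotent⇒shifted-unit-pair b m*n≡D (idempotent coprime[m,n])
    coprime[m,g] (coprime-n (coprime[1-2b,1+2b] b)) (coprime-n 1-2b⊥3)
  where open CoprimeSplitting (splitting (1ℤ - + 2 * b) M)

coprime[1-2b,3]⊎coprime[1+2b,3] : ∀ b →
  Coprime (1ℤ - + 2 * b) (+ 3) ⊎ Coprime (1ℤ - + 2 * - b) (+ 3)
coprime[1-2b,3]⊎coprime[1+2b,3] b =
  subst (λ b → Coprime (1ℤ - + 2 * b) (+ 3) ⊎ Coprime (1ℤ - + 2 * - b) (+ 3))
        (sym (a≡a%ℕn+[a/ℕn]*n b 3)) (by-residue (b %ℕ 3) (b /ℕ 3) (n%ℕd<d b 3))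
  where
  by-residue : ∀ r t → r ℕ.< 3 → let b = + r + t * + 3 in
               Coprime (1ℤ - + 2 * b) (+ 3) ⊎ Coprime (1ℤ - + 2 * - b) (+ 3)
  by-residue 0 t _ = inj₁ (1ℤ , + 2 * t , residue-0 t)
    where
    residue-0 : ∀ t → 1ℤ * (1ℤ - + 2 * (+ 0 + t * + 3)) + + 2 * t * + 3 ≡ 1ℤ
    residue-0 = solve-∀
  by-residue 1 t _ = inj₁ (- 1ℤ , - (+ 2 * t) , residue-1 t)
    where
    residue-1 : ∀ t → - 1ℤ * (1ℤ - + 2 * (+ 1 + t * + 3)) + - (+ 2 * t) * + 3 ≡ 1ℤ
    residue-1 = solve-∀
  by-residue 2 t _ = inj₂ (+ 2 , - (+ 3 + + 4 * t) , residue-2 t)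
    where
    residue-2 : ∀ t → + 2 * (1ℤ - + 2 * - (+ 2 + t * + 3)) + - (+ 3 + + 4 * t) * + 3 ≡ 1ℤ
    residue-2 = solve-∀
  by-residue (suc (suc (suc _))) _ (s≤s (s≤s (s≤s ())))

pair⊎negated-pair⇒solution : ∀ {D b} → ShiftedUnitPair D (b * + 4) ⊎ ShiftedUnitPair D (- b * + 4) →
  ∃₂ λ v₁ v₂ → (gcd D v₁ ≡ 1ℤ) × (gcd D v₂ ≡ 1ℤ) ×
    (CongMod D ((v₁ - 1ℤ) * (v₂ - 1ℤ)) (b * + 4) ⊎ CongMod D ((v₁ + 1ℤ) * (v₂ - 1ℤ)) (b * + 4))
pair⊎negated-pair⇒solution (inj₁ (v₁ , v₂ , D⊥v₁ , D⊥v₂ , D∣)) =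
  v₁ , v₂ , coprime⇒gcd≡1 D⊥v₁ , coprime⇒gcd≡1 D⊥v₂ , inj₁ (∣⇒∣ᵤ D∣)
pair⊎negated-pair⇒solution {D} {b} (inj₂ (w₁ , v₂ , D⊥w₁ , D⊥v₂ , D∣)) =
  - w₁ , v₂ , coprime⇒gcd≡1 (coprime-neg D⊥w₁) , coprime⇒gcd≡1 D⊥v₂ ,
  inj₂ (∣⇒∣ᵤ (subst (D Signed.∣_) (negate w₁ v₂ b) (∣m⇒∣-m D∣)))
  where
  negate : ∀ w v b → - ((w - 1ℤ) * (v - 1ℤ) - - b * + 4) ≡ (- w + 1ℤ) * (v - 1ℤ) - b * + 4
  negate = solve-∀

lemma2 : (D a : ℤ) → 0ℤ < D → (+ 4) ∣ a →
    ∃₂ λ v₁ v₂ → (gcd D v₁ ≡ 1ℤ) × (gcd D v₂ ≡ 1ℤ) ×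
      (CongMod D ((v₁ - 1ℤ) * (v₂ - 1ℤ)) a ⊎ CongMod D ((v₁ + 1ℤ) * (v₂ - 1ℤ)) a)
lemma2 (+ M) a (+<+ 0<M) 4∣a with ∣ᵤ⇒∣ {+ 4} {a} 4∣a
... | divides b refl = pair⊎negated-pair⇒solution {+ M} {b}
  (Sum.map (shifted-unit-pair b M {{>-nonZero 0<M}}) (shifted-unit-pair (- b) M {{>-nonZero 0<M}})
           (coprime[1-2b,3]⊎coprime[1+2b,3] b))
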